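{- If $G$ is a well-behaved signed graph with a good theta-pair, then there exist cycles $C_0,C_1$ of $G$ such that: (1) $C_1$ is negative and $C_0$ is good; (2) $|V_2(G)\cap V(C_1)|\ge 2$; (3) $G-V(C_0)$ and $G-V(C_1)$ have the same negative cycles.
   Context: Graphs are finite, may have multiple edges and loops; a cycle is negative if it has an odd number of negative edges, positive otherwise; a signed graph is balanced if it has no negative cycle. Subcubic means maximum degree at most 3; $V_i(G)$ is the set of vertices of degree $i$ in $G$; $d(X)$ is the number of edges with exactly one end in $X$. $G$ is well-behaved if it is subcubic and for every non-empty $X\subseteq V(G)$: (i) $3\le d(X)+\sum_{x\in X}(3-\deg(x))$; (ii) if $G[X]$ is balanced and $|X|\ge2$ then $4\le d(X)+\sum_{x\in X}(3-\deg(x))$. A cycle $C$ is good if it is a positive cycle containing at least two vertices of $V_2(G)$ (more generally a single vertex of degree 0 or 1 also counts as a good generalized cycle). A pair $(D,Q)$ of subgraphs of $G$ is a good theta-pair if $D$ is a negative cycle, $Q$ is a path with both ends in $V(D)$ and internally disjoint from $V(D)$, and $|V(Q)\cap V_2(G)|\ge2$. -}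

module Defs where

open import Data.Nat using (ℕ; zero; suc; _+_; _∸_; _≤_; _%_)
open import Data.Fin using (Fin; zero; suc; inject₁; fromℕ; _≟_)
open import Data.Fin.Subset using (Subset; Nonempty; _∈_)
open import Data.Vec using (lookup)
open import Data.Bool using (Bool; true; false; if_then_else_; _xor_)
open import Data.List using (List; map; allFin)
open import Data.Nat.ListAction using (sum)
open import Data.Product using (Σ; ∃; _×_; _,_; proj₁; proj₂)
open import Data.Sum using (_⊎_)
open import Relation.Nullary using (¬_; does)
open import Relation.Binary.PropositionalEquality using (_≡_; _≢_)

sumFin : (k : ℕ) → (Fin k → ℕ) → ℕ
sumFin k f = sum (map f (allFin k))

record SignedGraph : Set where
  field
    n    : ℕ
    m    : ℕ
    ends : Fin m → Fin n × Fin n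
    neg  : Fin m → Bool

module _ (G : SignedGraph) where
  open SignedGraph G

  V : Set
  V = Fin n

  E : Set
  E = Fin m

  ind : Bool → ℕ
  ind b = if b then 1 else 0

  -- degree: a loop contributes 2
  deg : V → ℕ
  deg v = sumFin m λ e → ind (does (proj₁ (ends e) ≟ v)) + ind (does (proj₂ (ends e) ≟ v))

  Subcubic : Set
  Subcubic = ∀ v → deg v ≤ 3

  Joins : E → V → V → Set
  Joins e u v = (ends e ≡ (u , v)) ⊎ (ends e ≡ (v , u))

  -- A cycle with k = suc len vertices v₀ … v_len and edges e₀ … e_len,
  -- e_i joining v_i and v_{i+1}, and e_len joining v_len and v₀.
  -- (len = 0: a loop; len = 1: two parallel edges.)
  record Cycle : Set where
    field
      len       : ℕ
      verts     : Fin (suc len) → V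
      edges     : Fin (suc len) → E
      verts-inj : ∀ i j → verts i ≡ verts j → i ≡ j
      edges-inj : ∀ i j → edges i ≡ edges j → i ≡ j
      link      : ∀ (i : Fin len) → Joins (edges (inject₁ i)) (verts (inject₁ i)) (verts (suc i))
      close     : Joins (edges (fromℕ len)) (verts (fromℕ len)) (verts zero)

  record Path : Set where
    field
      len       : ℕ
      verts     : Fin (suc len) → V
      edges     : Fin len → E
      verts-inj : ∀ i j → verts i ≡ verts j → i ≡ j
      edges-inj : ∀ i j → edges i ≡ edges j → i ≡ j
      link      : ∀ (i : Fin len) → Joins (edges i) (verts (inject₁ i)) (verts (suc i))

  negCount : Cycle → ℕ
  negCount C = sumFin (suc (Cycle.len C)) λ i → ind (neg (Cycle.edges C i))

  NegativeCycle : Cycle → Set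
  NegativeCycle C = negCount C % 2 ≡ 1

  PositiveCycle : Cycle → Set
  PositiveCycle C = negCount C % 2 ≡ 0

  _∈V_ : V → Cycle → Set
  v ∈V C = ∃ λ i → Cycle.verts C i ≡ v

  _∈E_ : E → Cycle → Set
  e ∈E C = ∃ λ i → Cycle.edges C i ≡ e

  TwoV2Cycle : Cycle → Set
  TwoV2Cycle C = Σ (Fin (suc (Cycle.len C))) λ i → Σ (Fin (suc (Cycle.len C))) λ j →
    (i ≢ j) × (deg (Cycle.verts C i) ≡ 2) × (deg (Cycle.verts C j) ≡ 2)

  TwoV2Path : Path → Set
  TwoV2Path Q = Σ (Fin (suc (Path.len Q))) λ i → Σ (Fin (suc (Path.len Q))) λ j →
    (i ≢ j) × (deg (Path.verts Q i) ≡ 2) × (deg (Path.verts Q j) ≡ 2)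

  GoodCycle : Cycle → Set
  GoodCycle C = PositiveCycle C × TwoV2Cycle C

  boundary : Subset n → ℕ
  boundary X = sumFin m λ e → ind (lookup X (proj₁ (ends e)) xor lookup X (proj₂ (ends e)))

  deficiency : Subset n → ℕ
  deficiency X = sumFin n λ x → if lookup X x then 3 ∸ deg x else 0

  BalancedOn : Subset n → Set
  BalancedOn X = ¬ (Σ Cycle λ C → NegativeCycle C × (∀ i → Cycle.verts C i ∈ X))

  AtLeastTwo : Subset n → Set
  AtLeastTwo X = Σ V λ x → Σ V λ y → (x ≢ y) × (x ∈ X) × (y ∈ X)

  WellBehaved : Set
  WellBehaved = Subcubic ×
    (∀ (X : Subset n) → Nonempty X →
       (3 ≤ boundary X + deficiency X) ×
       (BalancedOn X → AtLeastTwo X → 4 ≤ boundary X + deficiency X))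

  GoodThetaPair : Cycle → Path → Set
  GoodThetaPair D Q =
    NegativeCycle D ×
    (Path.verts Q zero ∈V D) ×
    (Path.verts Q (fromℕ (Path.len Q)) ∈V D) ×
    (∀ i → i ≢ zero → i ≢ fromℕ (Path.len Q) → ¬ (Path.verts Q i ∈V D)) ×
    (∀ i → ¬ (Path.edges Q i ∈E D)) ×
    TwoV2Path Q

  HasGoodThetaPair : Set
  HasGoodThetaPair = Σ Cycle λ D → Σ Path λ Q → GoodThetaPair D Q

  -- D is a cycle of G - V(C), i.e. D avoids all vertices of C
  Avoids : Cycle → Cycle → Set
  Avoids D C = ∀ v → v ∈V D → ¬ (v ∈V C)

-- Cutting the negative cycle D of a theta-pair (D , Q) at the two ends of Q leaves two arcs;
-- closing Q with either arc gives two cycles through Q whose numbers of negative edges add up to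
-- that of D plus twice that of Q, so one of them is positive and the other negative. If some
-- negative cycle D′ avoids one of them but meets the other, then D′ avoids Q, and the maximal
-- segment of the other cycle around Q that avoids D′ is the ear of a theta-pair with negative
-- cycle D′ and a strictly longer ear containing Q. That segment cannot be the whole cycle but one
-- vertex x, for x would carry two edges of D′ and two further edges, against subcubicity (the
-- only part of well-behavedness that is used). Ears have at most n vertices, so the process
-- stops at two cycles whose complements have the same negative cycles, both still containing the
-- two vertices of degree 2 on Q. Whether a distinguishing negative cycle exists is decided by
-- exhaustive search over lists of at most n steps.

module Submission where

open import Defs
open import Data.Product using (Σ; _×_)
open import Function.Bundles using (_⇔_)

open import Data.Empty using (⊥-elim)
open import Data.Fin as Fin using (Fin; zero; suc; inject₁; fromℕ)
import Data.Fin.Properties as Fin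
open import Data.List using (List; []; _∷_; _++_; [_]; map; length; lookup; tabulate; allFin; reverse; filter; initLast; _∷ʳ′_)
open import Data.List.Properties using (map-++; map-∘; ++-assoc; ++-identityʳ; ++-conicalʳ; map-tabulate; tabulate-lookup; length-++; length-map; map-id; unfold-reverse)
open import Data.List.Membership.Propositional using (_∈_; _∉_)
open import Data.List.Membership.Propositional.Properties using (∈-map⁺; ∈-map⁻; ∈-++⁺ˡ; ∈-++⁺ʳ; ∈-++⁻; ∈-∃++; ∈-lookup; ∈-allFin; ∈-filter⁺; ∈-filter⁻; ∈-tabulate⁺; ∈-tabulate⁻)
open import Data.List.Relation.Unary.All as All using (All; []; _∷_)
open import Data.List.Relation.Unary.All.Properties as All using (All¬⇒¬Any)
open import Data.List.Relation.Unary.Any as Any using (Any; here; there)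
import Data.List.Relation.Unary.Any.Properties as Any
open import Data.List.Relation.Unary.AllPairs using ([]; _∷_)
open import Data.List.Relation.Unary.Unique.Propositional using (Unique)
import Data.List.Relation.Unary.Unique.Propositional.Properties as Unique
import Data.List.Relation.Unary.Unique.DecPropositional
open import Data.List.Relation.Binary.Disjoint.Propositional using (Disjoint)
open import Data.List.Relation.Binary.Subset.Propositional using (_⊆_)
import Data.List.Relation.Binary.Subset.Propositional.Properties as Subset
open import Data.List.Relation.Binary.Permutation.Propositional using (_↭_; ↭-refl; ↭-sym; ↭⇒↭ₛ)
import Data.List.Relation.Binary.Permutation.Propositional.Properties as ↭
import Data.List.Relation.Binary.Permutation.Setoid.Properties as ↭ₛ
open import Data.List.Relation.Binary.BagAndSetEquality using (∼bag⇒↭)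
open import Data.List.Membership.Propositional.Properties.WithK using (unique∧set⇒bag)
open import Data.Nat using (ℕ; zero; suc; _+_; _*_; _≤_; _<_; _%_; z≤n; s≤s)
open import Data.Nat.DivMod using ([m+kn]%n≡m%n; %-distribˡ-+; m%n<n)
import Data.Nat.Properties as ℕ
open import Data.Nat.Tactic.RingSolver using (solve-∀)
open import Data.Nat.ListAction using (sum)
open import Data.Nat.ListAction.Properties using (sum-++; sum-↭)
open import Data.Product using (∃; ∃₂; _,_; proj₁; proj₂)
import Data.Product.Properties as ×
open import Data.Sum using (_⊎_; inj₁; inj₂; swap)
open import Function using (_∘_; id; mk⇔)
import Function.Properties.Equivalence as ⇔
open import Relation.Binary.PropositionalEquality using (_≡_; _≢_; refl; sym; trans; cong; cong₂; subst; setoid; module ≡-Reasoning)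
open import Relation.Nullary using (¬_; Dec; yes; no; does)
open import Relation.Nullary.Decidable using (map′; _×-dec_; _⊎-dec_; dec-true)
open import Relation.Unary using (Decidable)

-- Lists, finite search, parity

module _ {A : Set} where

  Unique-↭ : {xs ys : List A} → xs ↭ ys → Unique xs → Unique ys
  Unique-↭ p = ↭ₛ.Unique-resp-↭ (setoid A) (↭⇒↭ₛ p)

  Unique-++⁻ : ∀ xs {ys : List A} → Unique (xs ++ ys) → Unique xs × Unique ys × Disjoint xs ys
  Unique-++⁻ []       u          = [] , u , λ ()
  Unique-++⁻ (x ∷ xs) (x∉ ∷ u) with Unique-++⁻ xs u
  ... | uxs , uys , disjoint = All.++⁻ˡ xs x∉ ∷ uxs , uys , λ where
    (here refl , v∈ys) → All.lookup (All.++⁻ʳ xs x∉) v∈ys refl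
    (there v∈xs , v∈ys) → disjoint (v∈xs , v∈ys)

  Unique-prefix : ∀ xs {y} {ys : List A} → Unique (xs ++ y ∷ ys) → Unique (xs ++ [ y ])
  Unique-prefix xs u with Unique-++⁻ xs u
  ... | uxs , _ , disjoint = Unique.++⁺ uxs ([] ∷ []) λ where (v∈xs , here refl) → disjoint (v∈xs , here refl)

  lookup-injective : ∀ {B : Set} (f : A → B) xs → Unique (map f xs) →
                     ∀ {i j} → f (lookup xs i) ≡ f (lookup xs j) → i ≡ j
  lookup-injective f (x ∷ xs) _          {zero}  {zero}  _  = refl
  lookup-injective f (x ∷ xs) (fx∉ ∷ _)  {zero}  {suc j} eq =
    ⊥-elim (All.lookup fx∉ (∈-map⁺ f (∈-lookup {xs = xs} j)) eq)
  lookup-injective f (x ∷ xs) (fx∉ ∷ _)  {suc i} {zero}  eq =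
    ⊥-elim (All.lookup fx∉ (∈-map⁺ f (∈-lookup {xs = xs} i)) (sym eq))
  lookup-injective f (x ∷ xs) (_ ∷ u)    {suc i} {suc j} eq = cong suc (lookup-injective f xs u eq)

  data Span (P : A → Set) : List A → Set where
    single : ∀ {xs x zs} → All (¬_ ∘ P) xs → P x → All (¬_ ∘ P) zs → Span P (xs ++ x ∷ zs)
    double : ∀ {xs y ys x zs} → All (¬_ ∘ P) xs → P y → P x → All (¬_ ∘ P) zs →
             Span P (xs ++ y ∷ ys ++ x ∷ zs)

  data LastView (P : A → Set) : List A → Set where
    none : ∀ {xs} → All (¬_ ∘ P) xs → LastView P xs
    last : ∀ ys {z zs} → P z → All (¬_ ∘ P) zs → LastView P (ys ++ z ∷ zs)

  module _ {P : A → Set} (P? : Decidable P) where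

    lastView : ∀ xs → LastView P xs
    lastView []       = none []
    lastView (x ∷ xs) with lastView xs
    ... | last ys pz ¬pzs = last (x ∷ ys) pz ¬pzs
    ... | none ¬pxs with P? x
    ...   | yes px = last [] px ¬pxs
    ...   | no ¬px = none (¬px ∷ ¬pxs)

    span : ∀ {xs} → Any P xs → Span P xs
    span {x ∷ xs} any with P? x
    span {x ∷ xs} any         | yes px with lastView xs
    ... | none ¬pxs          = single [] px ¬pxs
    ... | last ys pz ¬pzs    = double [] px pz ¬pzs
    span {x ∷ xs} (here px)   | no ¬px = ⊥-elim (¬px px)
    span {x ∷ xs} (there any) | no ¬px with span any
    ... | single ¬pys px′ ¬pzs    = single (¬px ∷ ¬pys) px′ ¬pzs
    ... | double ¬pys py px′ ¬pzs = double (¬px ∷ ¬pys) py px′ ¬pzs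

map-lookup-allFin : ∀ {A B : Set} (f : A → B) xs → map (f ∘ lookup xs) (allFin (length xs)) ≡ map f xs
map-lookup-allFin f xs =
  trans (map-tabulate id (f ∘ lookup xs)) (trans (sym (map-tabulate (lookup xs) f)) (cong (map f) (tabulate-lookup xs)))

Unique-length≤ : ∀ {k} {xs : List (Fin k)} → Unique xs → length xs ≤ k
Unique-length≤ {xs = xs} u = Fin.injective⇒≤ (lookup-injective id xs (subst Unique (sym (map-id xs)) u))

Searchable : Set → Set₁
Searchable A = ∀ {P : A → Set} → Decidable P → Dec (∃ P)

module _ {A : Set} (search : Searchable A) where

  ×-searchable : {B : Set} → Searchable B → Searchable (A × B)
  ×-searchable searchB P? =
    map′ (λ (a , b , p) → (a , b) , p) (λ ((a , b) , p) → a , b , p)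
         (search λ a → searchB λ b → P? (a , b))

  short-lists-searchable : ∀ k {P : List A → Set} → Decidable P → Dec (∃ λ xs → length xs ≤ k × P xs)
  short-lists-searchable zero    P? = map′ (λ p → [] , z≤n , p) (λ where ([] , _ , p) → p) (P? [])
  short-lists-searchable (suc k) {P} P? =
    map′ to from (P? [] ⊎-dec search λ x → short-lists-searchable k (P? ∘ (x ∷_)))
    where
    to : P [] ⊎ ∃ (λ x → ∃ λ xs → length xs ≤ k × P (x ∷ xs)) → ∃ λ xs → length xs ≤ suc k × P xs
    to (inj₁ p)                = [] , z≤n , p
    to (inj₂ (x , xs , l , p)) = x ∷ xs , s≤s l , p
    from : (∃ λ xs → length xs ≤ suc k × P xs) → P [] ⊎ ∃ (λ x → ∃ λ xs → length xs ≤ k × P (x ∷ xs))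
    from ([] , _ , p)           = inj₁ p
    from (x ∷ xs , s≤s l , p)   = inj₂ (x , xs , l , p)

sum-unique≤sumFin : ∀ {k} (f : Fin k → ℕ) {es : List (Fin k)} → Unique es → sum (map f es) ≤ sumFin k f
sum-unique≤sumFin {k} f {es} u = begin
  sum (map f es)                     ≤⟨ ℕ.m≤m+n _ _ ⟩
  sum (map f es) + sum (map f rest)  ≡⟨ sum-++ (map f es) (map f rest) ⟨
  sum (map f es ++ map f rest)       ≡⟨ cong sum (map-++ f es rest) ⟨
  sum (map f (es ++ rest))           ≡⟨ sum-↭ (↭.map⁺ f es++rest↭allFin) ⟩
  sum (map f (allFin k))             ∎
  where
  open ℕ.≤-Reasoning
  open import Data.List.Membership.DecPropositional (Fin._≟_ {k}) using (_∈?_; _∉?_)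
  rest = filter (_∉? es) (allFin k)
  es++rest↭allFin : es ++ rest ↭ allFin k
  es++rest↭allFin = ∼bag⇒↭ (unique∧set⇒bag
    (Unique.++⁺ u (Unique.filter⁺ (_∉? es) {allFin k} (Unique.allFin⁺ k))
                λ where (e∈es , e∈rest) → proj₂ (∈-filter⁻ (_∉? es) {xs = allFin k} e∈rest) e∈es)
    (Unique.allFin⁺ k)
    λ {e} → mk⇔ (λ _ → ∈-allFin e) (λ _ → case-∈ e (e ∈? es)))
    where
    case-∈ : ∀ e → Dec (e ∈ es) → e ∈ es ++ rest
    case-∈ e (yes e∈es) = ∈-++⁺ˡ e∈es
    case-∈ e (no e∉es)  = ∈-++⁺ʳ es (∈-filter⁺ (_∉? es) (∈-allFin e) e∉es)

odd-sum-parities : ∀ a b → (a + b) % 2 ≡ 1 → (a % 2 ≡ 0 × b % 2 ≡ 1) ⊎ (a % 2 ≡ 1 × b % 2 ≡ 0)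
odd-sum-parities a b odd =
  digits (a % 2) (b % 2) (m%n<n a 2) (m%n<n b 2) (trans (sym (%-distribˡ-+ a b 2)) odd)
  where
  digits : ∀ x y → x < 2 → y < 2 → (x + y) % 2 ≡ 1 → (x ≡ 0 × y ≡ 1) ⊎ (x ≡ 1 × y ≡ 0)
  digits 0 1 _ _ _ = inj₁ (refl , refl)
  digits 1 0 _ _ _ = inj₂ (refl , refl)
  digits 0 0 _ _ ()
  digits 1 1 _ _ ()
  digits (suc (suc _)) _ (s≤s (s≤s ())) _ _
  digits _ (suc (suc _)) _ (s≤s (s≤s ())) _

-- Walks, paths and cycles as lists of steps

module _ (G : SignedGraph) where
  open SignedGraph G using (ends; neg)

  joins-sym : ∀ {e u w} → Joins G e u w → Joins G e w u
  joins-sym = swap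

  joins-end : ∀ {e u w v x} → Joins G e u w → Joins G e v x → u ≡ v ⊎ u ≡ x
  joins-end (inj₁ p) (inj₁ q) = inj₁ (cong proj₁ (trans (sym p) q))
  joins-end (inj₁ p) (inj₂ q) = inj₂ (cong proj₁ (trans (sym p) q))
  joins-end (inj₂ p) (inj₁ q) = inj₂ (cong proj₂ (trans (sym p) q))
  joins-end (inj₂ p) (inj₂ q) = inj₁ (cong proj₂ (trans (sym p) q))

  incidence : V G → E G → ℕ
  incidence v e = ind G (does (proj₁ (ends e) Fin.≟ v)) + ind G (does (proj₂ (ends e) Fin.≟ v))

  incidences : V G → List (E G) → ℕ
  incidences v es = sum (map (incidence v) es)

  incidences≤deg : ∀ v {es} → Unique es → incidences v es ≤ deg G v
  incidences≤deg v = sum-unique≤sumFin (incidence v)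

  1≤incidence : ∀ {e v w} → Joins G e v w → 1 ≤ incidence v e
  1≤incidence {e} {v} (inj₁ p) rewrite p | dec-true (v Fin.≟ v) refl = s≤s z≤n
  1≤incidence {e} {v} (inj₂ p) rewrite p | dec-true (v Fin.≟ v) refl = ℕ.m≤n+m 1 _

  2≤incidence-loop : ∀ {e v} → Joins G e v v → 2 ≤ incidence v e
  2≤incidence-loop {e} {v} (inj₁ p) rewrite p | dec-true (v Fin.≟ v) refl = ℕ.≤-refl
  2≤incidence-loop {e} {v} (inj₂ p) rewrite p | dec-true (v Fin.≟ v) refl = ℕ.≤-refl

  Step : Set
  Step = V G × E G

  vertices : List Step → List (V G)
  vertices = map proj₁

  edges : List Step → List (E G)
  edges = map proj₂

  pathVertices : V G → List Step → List (V G)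
  pathVertices t ss = vertices ss ++ [ t ]

  first : V G → List Step → V G
  first t []            = t
  first t ((v , _) ∷ _) = v

  -- A step (v , e) leaves v along e towards the vertex of the next step; the last step
  -- leads to the target t.
  data Linked (t : V G) : List Step → Set where
    []  : Linked t []
    _∷_ : ∀ {v e ss} → Joins G e v (first t ss) → Linked t ss → Linked t ((v , e) ∷ ss)

  first-++ : ∀ t xs ys → first t (xs ++ ys) ≡ first (first t ys) xs
  first-++ t []      ys = refl
  first-++ t (_ ∷ _) ys = refl

  first-∈ : ∀ t ss → first t ss ∈ pathVertices t ss
  first-∈ t []      = here refl
  first-∈ t (_ ∷ _) = here refl

  Linked-++⁻ : ∀ {t} xs {ys} → Linked t (xs ++ ys) → Linked (first t ys) xs × Linked t ys
  Linked-++⁻ []                       linked       = [] , linked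
  Linked-++⁻ {t} ((v , e) ∷ xs) {ys} (j ∷ linked) =
    subst (Joins G e v) (first-++ t xs ys) j ∷ proj₁ (Linked-++⁻ xs linked) , proj₂ (Linked-++⁻ xs linked)

  Linked-++⁺ : ∀ {t} xs {ys} → Linked (first t ys) xs → Linked t ys → Linked t (xs ++ ys)
  Linked-++⁺ []                  []         lys = lys
  Linked-++⁺ {t} ((v , e) ∷ xs) {ys} (j ∷ lxs) lys =
    subst (Joins G e v) (sym (first-++ t xs ys)) j ∷ Linked-++⁺ xs lxs lys

  Linked-joins : ∀ {t ss v e} → Linked t ss → (v , e) ∈ ss → ∃ λ w → Joins G e v w × w ∈ pathVertices t ss
  Linked-joins {t} {(_ ∷ ss)} (j ∷ _) (here refl) = first t ss , j , there (first-∈ t ss)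
  Linked-joins (_ ∷ linked) (there s∈ss) with Linked-joins linked s∈ss
  ... | w , j , w∈ss = w , j , there w∈ss

  Linked-head : ∀ {t v e ss} → Linked t ((v , e) ∷ ss) → Joins G e v (first t ss)
  Linked-head (j ∷ _) = j

  Linked-last : ∀ {t} xs {v e} → Linked t (xs ++ [ (v , e) ]) → Joins G e v t
  Linked-last xs linked = Linked-head (proj₂ (Linked-++⁻ xs linked))

  rev : V G → List Step → List Step
  rev t []             = []
  rev t ((v , e) ∷ ss) = rev t ss ++ [ (first t ss , e) ]

  Linked-rev : ∀ {t} ss → Linked t ss → Linked (first t ss) (rev t ss)
  Linked-rev []                 []        = []
  Linked-rev {t} ((v , e) ∷ ss) (j ∷ linked) = Linked-++⁺ (rev t ss) (Linked-rev ss linked) (joins-sym j ∷ [])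

  first-rev : ∀ t ss → first (first t ss) (rev t ss) ≡ t
  first-rev t []             = refl
  first-rev t ((v , e) ∷ ss) = trans (first-++ v (rev t ss) _) (first-rev t ss)

  pathVertices-rev : ∀ t ss → pathVertices (first t ss) (rev t ss) ≡ reverse (pathVertices t ss)
  pathVertices-rev t []             = refl
  pathVertices-rev t ((v , e) ∷ ss) = begin
    vertices (rev t ss ++ [ (first t ss , e) ]) ++ [ v ]  ≡⟨ cong (_++ [ v ]) (map-++ proj₁ (rev t ss) _) ⟩
    pathVertices (first t ss) (rev t ss) ++ [ v ]          ≡⟨ cong (_++ [ v ]) (pathVertices-rev t ss) ⟩
    reverse (pathVertices t ss) ++ [ v ]                   ≡⟨ unfold-reverse v (pathVertices t ss) ⟨
    reverse (v ∷ pathVertices t ss)                        ∎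
    where open ≡-Reasoning

  edges-rev : ∀ t ss → edges (rev t ss) ≡ reverse (edges ss)
  edges-rev t []             = refl
  edges-rev t ((v , e) ∷ ss) = begin
    edges (rev t ss ++ [ (first t ss , e) ])  ≡⟨ map-++ proj₂ (rev t ss) _ ⟩
    edges (rev t ss) ++ [ e ]                 ≡⟨ cong (_++ [ e ]) (edges-rev t ss) ⟩
    reverse (edges ss) ++ [ e ]               ≡⟨ unfold-reverse e (edges ss) ⟨
    reverse (e ∷ edges ss)                    ∎
    where open ≡-Reasoning

  sign : E G → ℕ
  sign e = ind G (neg e)

  negatives : List Step → ℕ
  negatives ss = sum (map sign (edges ss))

  Negative : List Step → Set
  Negative ss = negatives ss % 2 ≡ 1

  negatives-++ : ∀ xs ys → negatives (xs ++ ys) ≡ negatives xs + negatives ys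
  negatives-++ xs ys = begin
    sum (map sign (edges (xs ++ ys)))                  ≡⟨ cong (sum ∘ map sign) (map-++ proj₂ xs ys) ⟩
    sum (map sign (edges xs ++ edges ys))              ≡⟨ cong sum (map-++ sign (edges xs) (edges ys)) ⟩
    sum (map sign (edges xs) ++ map sign (edges ys))   ≡⟨ sum-++ (map sign (edges xs)) _ ⟩
    negatives xs + negatives ys                        ∎
    where open ≡-Reasoning

  negatives-↭ : ∀ {xs ys} → xs ↭ ys → negatives xs ≡ negatives ys
  negatives-↭ p = sum-↭ (↭.map⁺ sign (↭.map⁺ proj₂ p))

  negatives-rev : ∀ t ss → negatives (rev t ss) ≡ negatives ss
  negatives-rev t ss =
    sum-↭ (↭.map⁺ sign (subst (_↭ edges ss) (sym (edges-rev t ss)) (↭.↭-reverse (edges ss))))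

  record IsPath (t : V G) (ss : List Step) : Set where
    constructor path
    field
      linked          : Linked t ss
      vertices-unique : Unique (pathVertices t ss)
      edges-unique    : Unique (edges ss)

  data IsCycle : List Step → Set where
    cycle : ∀ {s ss} → Linked (proj₁ s) (s ∷ ss) → Unique (vertices (s ∷ ss)) → Unique (edges (s ∷ ss)) →
            IsCycle (s ∷ ss)

  cycle-vertices-unique : ∀ {ss} → IsCycle ss → Unique (vertices ss)
  cycle-vertices-unique (cycle _ uv _) = uv

  cycle-length≤ : ∀ {ss} → IsCycle ss → length ss ≤ SignedGraph.n G
  cycle-length≤ {ss} c = Fin.injective⇒≤ (lookup-injective proj₁ ss (cycle-vertices-unique c))

  IsPath-rev : ∀ {t ss} → IsPath t ss → IsPath (first t ss) (rev t ss)
  IsPath-rev {t} {ss} (path linked uv ue) = path (Linked-rev ss linked)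
    (subst Unique (sym (pathVertices-rev t ss)) (Unique-↭ (↭-sym (↭.↭-reverse _)) uv))
    (subst Unique (sym (edges-rev t ss)) (Unique-↭ (↭-sym (↭.↭-reverse _)) ue))

  IsCycle-rotate : ∀ xs ys → IsCycle (xs ++ ys) → IsCycle (ys ++ xs)
  IsCycle-rotate []       ys       c = subst IsCycle (sym (++-identityʳ ys)) c
  IsCycle-rotate (x ∷ xs) []       c = subst IsCycle (++-identityʳ (x ∷ xs)) c
  IsCycle-rotate (x ∷ xs) (y ∷ ys) (cycle linked uv ue) = cycle
    (Linked-++⁺ (y ∷ ys) (proj₂ (Linked-++⁻ (x ∷ xs) linked)) (proj₁ (Linked-++⁻ (x ∷ xs) linked)))
    (rotated uv) (rotated ue)
    where
    rotated : ∀ {B} {f : Step → B} → Unique (map f ((x ∷ xs) ++ (y ∷ ys))) → Unique (map f ((y ∷ ys) ++ (x ∷ xs)))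
    rotated = Unique-↭ (↭.map⁺ _ (↭.++-comm (x ∷ xs) (y ∷ ys)))

  IsCycle-rotate₃ : ∀ xs ys zs → IsCycle (xs ++ ys ++ zs) → IsCycle ((zs ++ xs) ++ ys)
  IsCycle-rotate₃ xs ys zs c =
    subst IsCycle (sym (++-assoc zs xs ys)) (IsCycle-rotate (xs ++ ys) zs (subst IsCycle (sym (++-assoc xs ys zs)) c))

  rotate-to : ∀ {ss v} → IsCycle ss → v ∈ vertices ss →
              ∃₂ λ e rest → IsCycle ((v , e) ∷ rest) × (v , e) ∷ rest ↭ ss
  rotate-to c v∈ss with ∈-map⁻ proj₁ v∈ss
  ... | (v , e) , s∈ss , refl with ∈-∃++ s∈ss
  ... | xs , ys , refl = e , ys ++ xs , IsCycle-rotate xs ((v , e) ∷ ys) c , ↭.++-comm ((v , e) ∷ ys) xs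

  cycle-prefix-path : ∀ xs {y ys} → IsCycle (xs ++ y ∷ ys) → IsPath (proj₁ y) xs
  cycle-prefix-path []       _ = path [] ([] ∷ []) []
  cycle-prefix-path (x ∷ xs) {y} {ys} (cycle linked uv ue) = path
    (proj₁ (Linked-++⁻ (x ∷ xs) linked))
    (Unique-prefix (vertices (x ∷ xs)) (subst Unique (map-++ proj₁ (x ∷ xs) (y ∷ ys)) uv))
    (proj₁ (Unique-++⁻ (edges (x ∷ xs)) (subst Unique (map-++ proj₂ (x ∷ xs) (y ∷ ys)) ue)))

  glue-paths : ∀ {t p ps rs} → IsPath t (p ∷ ps) → IsPath (proj₁ p) rs → first (proj₁ p) rs ≡ t →
         Disjoint (vertices (p ∷ ps)) (vertices rs) → Disjoint (edges (p ∷ ps)) (edges rs) →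
         IsCycle (p ∷ ps ++ rs)
  glue-paths {t} {p} {ps} {rs} (path lp uvp uep) (path lr uvr uer) closes vdisj edisj = cycle
    (Linked-++⁺ (p ∷ ps) (subst (λ w → Linked w (p ∷ ps)) (sym closes) lp) lr)
    (subst Unique (sym (map-++ proj₁ (p ∷ ps) rs))
           (Unique.++⁺ (proj₁ (Unique-++⁻ (vertices (p ∷ ps)) uvp)) (proj₁ (Unique-++⁻ (vertices rs) uvr)) vdisj))
    (subst Unique (sym (map-++ proj₂ (p ∷ ps) rs)) (Unique.++⁺ uep uer edisj))

  cycle-edge-ends : ∀ {ss e u w} → IsCycle ss → e ∈ edges ss → Joins G e u w → u ∈ vertices ss
  cycle-edge-ends {s ∷ ss} (cycle linked _ _) e∈ss j with ∈-map⁻ proj₂ e∈ss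
  ... | (v , e) , step∈ss , refl with Linked-joins linked step∈ss
  ... | w , j′ , w∈ with joins-end j j′
  ... | inj₁ refl = ∈-map⁺ proj₁ step∈ss
  ... | inj₂ refl with ∈-++⁻ (vertices (s ∷ ss)) w∈
  ...   | inj₁ w∈ss        = w∈ss
  ...   | inj₂ (here refl) = here refl

  first-∈-nonempty : ∀ t {ss} → ss ≢ [] → first t ss ∈ vertices ss
  first-∈-nonempty t {[]}    ss≢[] = ⊥-elim (ss≢[] refl)
  first-∈-nonempty t {_ ∷ _} _     = here refl

  pathVertices⊆ : ∀ P u e rest → pathVertices u P ⊆ vertices (P ++ (u , e) ∷ rest)
  pathVertices⊆ P u e rest =
    Subset.⊆-trans (Subset.++⁺ (Subset.⊆-refl {x = vertices P}) u∈) (Subset.⊆-reflexive (sym (map-++ proj₁ P _)))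
    where
    u∈ : [ u ] ⊆ vertices ((u , e) ∷ rest)
    u∈ (here refl) = here refl

  cycle-incidences : ∀ {ss v} → IsCycle ss → v ∈ vertices ss →
                     ∃ λ es → Unique es × es ⊆ edges ss × 2 ≤ incidences v es
  cycle-incidences c v∈ss with rotate-to c v∈ss
  ... | e , rest , cycle linked _ ue , rotation with initLast rest
  ...   | [] with linked
  ...     | loop ∷ [] = [ e ] , [] ∷ [] , on-ss , ℕ.+-mono-≤ (2≤incidence-loop loop) z≤n
    where
    on-ss : [ e ] ⊆ edges _
    on-ss (here refl) = ↭.∈-resp-↭ (↭.map⁺ proj₂ rotation) (here refl)
  cycle-incidences c v∈ss
      | e , _ , cycle linked _ (e∉ ∷ _) , rotation | init ∷ʳ′ (w , f) =
    e ∷ f ∷ [] , (e≢f ∷ []) ∷ [] ∷ [] , on-ss ,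
    ℕ.+-mono-≤ (1≤incidence leave) (ℕ.+-mono-≤ (1≤incidence (joins-sym enter)) z≤n)
    where
    f∈ : f ∈ edges (init ++ [ (w , f) ])
    f∈ = ∈-map⁺ proj₂ (∈-++⁺ʳ init (here refl))
    e≢f : e ≢ f
    e≢f e≡f = All.lookup e∉ f∈ e≡f
    leave = Linked-head linked
    enter = Linked-last (_ ∷ init) linked
    on-ss : e ∷ f ∷ [] ⊆ edges _
    on-ss (here refl)         = ↭.∈-resp-↭ (↭.map⁺ proj₂ rotation) (here refl)
    on-ss (there (here refl)) = ↭.∈-resp-↭ (↭.map⁺ proj₂ rotation) (there f∈)

  single-contact⇒4≤deg : ∀ {ds x e W} → IsCycle ds → x ∈ vertices ds → IsCycle ((x , e) ∷ W) → W ≢ [] →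
                          All (_∉ vertices ds) (vertices W) → 4 ≤ deg G x
  single-contact⇒4≤deg {ds} {x} {e} {W} cds x∈ds (cycle linked _ (e∉W ∷ _)) W≢[] off with initLast W
  ... | [] = ⊥-elim (W≢[] refl)
  ... | init ∷ʳ′ (w , f) with cycle-incidences cds x∈ds
  ...   | es , unique-es , es⊆ds , 2≤ = begin
    4                          ≤⟨ ℕ.+-mono-≤ (1≤incidence leave) (ℕ.+-mono-≤ (1≤incidence (joins-sym enter)) 2≤) ⟩
    incidences x (e ∷ f ∷ es)  ≤⟨ incidences≤deg x ((e≢f ∷ apart e∉ds) ∷ apart f∉ds ∷ unique-es) ⟩
    deg G x                    ∎
    where
    open ℕ.≤-Reasoning
    leave = Linked-head linked
    enter = Linked-last ((x , e) ∷ init) linked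
    e∉ds : e ∉ edges ds
    e∉ds e∈ds = All.lookup off (first-∈-nonempty x W≢[]) (cycle-edge-ends cds e∈ds (joins-sym leave))
    f∉ds : f ∉ edges ds
    f∉ds f∈ds = All.lookup off (∈-map⁺ proj₁ (∈-++⁺ʳ init (here refl))) (cycle-edge-ends cds f∈ds enter)
    e≢f : e ≢ f
    e≢f = All.lookup e∉W (∈-map⁺ proj₂ (∈-++⁺ʳ init (here refl)))
    apart : ∀ {g} → g ∉ edges ds → All (g ≢_) es
    apart g∉ds = All.tabulate λ g′∈es g≡g′ → g∉ds (subst (_∈ edges ds) (sym g≡g′) (es⊆ds g′∈es))

  record Arcs (ss : List Step) (a b : V G) : Set where
    field
      e₀ e₁    : E G
      us ws    : List Step
      joined   : IsCycle ((a , e₀) ∷ us ++ (b , e₁) ∷ ws)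
      rotation : (a , e₀) ∷ us ++ (b , e₁) ∷ ws ↭ ss

    arc₁ arc₂ : List Step
    arc₁ = (a , e₀) ∷ us
    arc₂ = (b , e₁) ∷ ws

    arc₁-path : IsPath b arc₁
    arc₁-path = cycle-prefix-path arc₁ joined

    arc₂-path : IsPath a arc₂
    arc₂-path = cycle-prefix-path arc₂ (IsCycle-rotate arc₁ arc₂ joined)

    on-cycle : ∀ {B : Set} (f : Step → B) → map f arc₁ ⊆ map f ss × map f arc₂ ⊆ map f ss
    on-cycle f = Subset.⊆-trans (Subset.map⁺ f (Subset.xs⊆xs++ys arc₁ arc₂)) inside
               , Subset.⊆-trans (Subset.map⁺ f (Subset.xs⊆ys++xs arc₂ arc₁)) inside
      where inside = Subset.⊆-reflexive-↭ (↭.map⁺ f rotation)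

    negatives-arcs : negatives arc₁ + negatives arc₂ ≡ negatives ss
    negatives-arcs = trans (sym (negatives-++ arc₁ arc₂)) (negatives-↭ rotation)

  cut : ∀ {ss a b} → IsCycle ss → a ∈ vertices ss → b ∈ vertices ss → a ≢ b → Arcs ss a b
  cut c a∈ss b∈ss a≢b with rotate-to c a∈ss
  ... | e₀ , rest , c′ , rotation with ↭.∈-resp-↭ (↭-sym (↭.map⁺ proj₁ rotation)) b∈ss
  ...   | here b≡a = ⊥-elim (a≢b (sym b≡a))
  ...   | there b∈rest with ∈-map⁻ proj₁ b∈rest
  ...     | (b , e₁) , step∈rest , refl with ∈-∃++ step∈rest
  ...       | us , ws , refl = record { joined = c′ ; rotation = rotation }

  -- Theta-pairs and their two cycles through the ear

  vertices-rev-∷ : ∀ t s ss → vertices (rev t (s ∷ ss)) ≡ reverse (pathVertices t ss)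
  vertices-rev-∷ t s ss = trans (map-++ proj₁ (rev t ss) _) (pathVertices-rev t ss)

  -- A theta-pair (D , Q) without the condition on V₂: the path Q = ear₀ ∷ ear₊ runs from start
  -- to end, both on the negative cycle D = cyc, and shares no other vertex and no edge with D.
  record Theta : Set where
    field
      cyc               : List Step
      cyc-cycle         : IsCycle cyc
      cyc-negative      : Negative cyc
      ear₀              : Step
      ear₊              : List Step
      end               : V G
      ear-path          : IsPath end (ear₀ ∷ ear₊)
      start-on-cyc      : proj₁ ear₀ ∈ vertices cyc
      end-on-cyc        : end ∈ vertices cyc
      inner-off-cyc     : Disjoint (vertices ear₊) (vertices cyc)
      ear-edges-off-cyc : Disjoint (edges (ear₀ ∷ ear₊)) (edges cyc)

    ear : List Step
    ear = ear₀ ∷ ear₊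

    start : V G
    start = proj₁ ear₀

    earVertices : List (V G)
    earVertices = pathVertices end ear

    start≢end : start ≢ end
    start≢end with IsPath.vertices-unique ear-path
    ... | start∉ ∷ _ = All.lookup start∉ (∈-++⁺ʳ (vertices ear₊) (here refl))

  -- A cycle that begins by traversing the ear of θ, in either direction.
  record EarCycle (θ : Theta) : Set where
    field
      along     : List Step
      meet      : V G
      leave     : E G
      back      : List Step
      isCycle   : IsCycle (along ++ (meet , leave) ∷ back)
      along-ear : pathVertices meet along ↭ Theta.earVertices θ

    steps : List Step
    steps = along ++ (meet , leave) ∷ back

    ear⊆ : Theta.earVertices θ ⊆ vertices steps
    ear⊆ = Subset.⊆-trans (Subset.⊆-reflexive-↭ (↭-sym along-ear)) (pathVertices⊆ along meet leave back)

  module _ (θ : Theta) where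
    open Theta θ
    open Arcs (cut cyc-cycle start-on-cyc end-on-cyc start≢end)

    ear-then-arc₂ : EarCycle θ
    ear-then-arc₂ = record
      { along     = ear
      ; meet      = end
      ; leave     = e₁
      ; back      = ws
      ; isCycle   = glue-paths ear-path arc₂-path refl disjoint-vertices disjoint-edges
      ; along-ear = ↭-refl
      }
      where
      disjoint-vertices : Disjoint (vertices ear) (vertices arc₂)
      disjoint-vertices (here refl , v∈arc₂) =
        proj₂ (proj₂ (Unique-++⁻ (vertices arc₂) (IsPath.vertices-unique arc₂-path))) (v∈arc₂ , here refl)
      disjoint-vertices (there v∈ear₊ , v∈arc₂) = inner-off-cyc (v∈ear₊ , proj₂ (on-cycle proj₁) v∈arc₂)
      disjoint-edges : Disjoint (edges ear) (edges arc₂)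
      disjoint-edges (e∈ear , e∈arc₂) = ear-edges-off-cyc (e∈ear , proj₂ (on-cycle proj₂) e∈arc₂)

    reversed-ear-then-arc₁ : EarCycle θ
    reversed-ear-then-arc₁ = record
      { along     = rev end ear
      ; meet      = start
      ; leave     = e₀
      ; back      = us
      ; isCycle   = IsCycle-rotate arc₁ (rev end ear)
                      (glue-paths arc₁-path (IsPath-rev ear-path) (first-rev end ear) disjoint-vertices disjoint-edges)
      ; along-ear = subst (_↭ earVertices) (sym (pathVertices-rev end ear)) (↭.↭-reverse earVertices)
      }
      where
      disjoint-vertices : Disjoint (vertices arc₁) (vertices (rev end ear))
      disjoint-vertices (v∈arc₁ , v∈rev)
        with ∈-++⁻ (vertices ear₊) (Any.reverse⁻ (subst (_ ∈_) (vertices-rev-∷ end ear₀ ear₊) v∈rev))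
      ... | inj₁ v∈ear₊    = inner-off-cyc (v∈ear₊ , proj₁ (on-cycle proj₁) v∈arc₁)
      ... | inj₂ (here refl) =
        proj₂ (proj₂ (Unique-++⁻ (vertices arc₁) (IsPath.vertices-unique arc₁-path))) (v∈arc₁ , here refl)
      disjoint-edges : Disjoint (edges arc₁) (edges (rev end ear))
      disjoint-edges (e∈arc₁ , e∈rev) =
        ear-edges-off-cyc (Any.reverse⁻ (subst (_ ∈_) (edges-rev end ear) e∈rev) , proj₁ (on-cycle proj₂) e∈arc₁)

    ear-cycles-opposite :
      (negatives (EarCycle.steps ear-then-arc₂) + negatives (EarCycle.steps reversed-ear-then-arc₁)) % 2 ≡ 1
    ear-cycles-opposite = begin
      (negatives (ear ++ arc₂) + negatives (rev end ear ++ arc₁)) % 2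
        ≡⟨ cong (_% 2) (cong₂ _+_ (negatives-++ ear arc₂)
                                  (trans (negatives-++ (rev end ear) arc₁)
                                         (cong (_+ negatives arc₁) (negatives-rev end ear)))) ⟩
      ((negatives ear + negatives arc₂) + (negatives ear + negatives arc₁)) % 2
        ≡⟨ cong (_% 2) (rearrange (negatives ear) (negatives arc₁) (negatives arc₂)) ⟩
      (negatives arc₁ + negatives arc₂ + negatives ear * 2) % 2
        ≡⟨ [m+kn]%n≡m%n (negatives arc₁ + negatives arc₂) (negatives ear) 2 ⟩
      (negatives arc₁ + negatives arc₂) % 2
        ≡⟨ cong (_% 2) negatives-arcs ⟩
      negatives cyc % 2
        ≡⟨ cyc-negative ⟩
      1 ∎
      where
      open ≡-Reasoning
      rearrange : ∀ q a b → (q + b) + (q + a) ≡ a + b + q * 2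
      rearrange = solve-∀

  -- Growing the ear

  length-pathVertices : ∀ t ss → length (pathVertices t ss) ≡ suc (length ss)
  length-pathVertices t ss =
    trans (length-++ (vertices ss)) (trans (cong (_+ 1) (length-map proj₁ ss)) (ℕ.+-comm (length ss) 1))

  Extension : List (V G) → Set
  Extension S = Σ Theta λ θ′ → S ⊆ Theta.earVertices θ′ × length S < length (Theta.earVertices θ′)

  module _ (subcubic : Subcubic G) {ds} (ds-cycle : IsCycle ds) (ds-negative : Negative ds) where

    private
      On : Step → Set
      On s = proj₁ s ∈ vertices ds

      on? : Decidable On
      on? s = proj₁ s ∈? vertices ds
        where open import Data.List.Membership.DecPropositional (Fin._≟_ {SignedGraph.n G}) using (_∈?_)

      segment-nonempty : ∀ (tl P : List Step) s s₁ → tl ++ P ++ s ∷ s₁ ≢ []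
      segment-nonempty tl P s s₁ W≡[] with ++-conicalʳ P _ (++-conicalʳ tl _ W≡[])
      ... | ()

      off-vertices : ∀ {W} → All (¬_ ∘ On) W → Disjoint (vertices W) (vertices ds)
      off-vertices off-W (v∈W , v∈ds) = All.lookup (All.map⁺ off-W) v∈W v∈ds

    -- The new ear is the maximal segment of the cycle around P that avoids ds; if that segment
    -- were the whole cycle but one vertex x, then x would have degree 4.
    extend-along-span : ∀ {P u e rs} → Span On rs → IsCycle (P ++ (u , e) ∷ rs) →
                        All (¬_ ∘ On) P → ¬ On (u , e) → Extension (pathVertices u P)
    extend-along-span {P} {u} {e} (single {s₁} {x , eₓ} {tl} off-s₁ on-x off-tl) K off-P off-u =
      ⊥-elim (ℕ.<⇒≱ (single-contact⇒4≤deg ds-cycle on-x contact W≢[] (All.map⁺ off-W)) (subcubic x))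
      where
      W = tl ++ P ++ (u , e) ∷ s₁
      off-W : All (¬_ ∘ On) W
      off-W = All.++⁺ off-tl (All.++⁺ off-P (off-u ∷ off-s₁))
      W≢[] : W ≢ []
      W≢[] = segment-nonempty tl P (u , e) s₁
      contact : IsCycle ((x , eₓ) ∷ W)
      contact = IsCycle-rotate (P ++ (u , e) ∷ s₁) ((x , eₓ) ∷ tl)
                  (subst IsCycle (sym (++-assoc P ((u , e) ∷ s₁) _)) K)
    extend-along-span {P} {u} {e} (double {s₁} {y} {mid} {x , eₓ} {tl} off-s₁ on-y on-x off-tl) K off-P off-u =
      θ′ , P⊆ear , longer
      where
      W = tl ++ P ++ (u , e) ∷ s₁
      off-W : All (¬_ ∘ On) W
      off-W = All.++⁺ off-tl (All.++⁺ off-P (off-u ∷ off-s₁))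
      W≢[] : W ≢ []
      W≢[] = segment-nonempty tl P (u , e) s₁
      rotated : IsCycle (((x , eₓ) ∷ W) ++ y ∷ mid)
      rotated = IsCycle-rotate₃ (P ++ (u , e) ∷ s₁) (y ∷ mid) ((x , eₓ) ∷ tl)
                  (subst IsCycle (sym (++-assoc P ((u , e) ∷ s₁) _)) K)
      new-ear : IsPath (proj₁ y) ((x , eₓ) ∷ W)
      new-ear = cycle-prefix-path ((x , eₓ) ∷ W) rotated
      edges-off : Disjoint (edges ((x , eₓ) ∷ W)) (edges ds)
      edges-off (here refl , eₓ∈ds) =
        All.lookup (All.map⁺ off-W) (first-∈-nonempty (proj₁ y) W≢[])
          (cycle-edge-ends ds-cycle eₓ∈ds (joins-sym (Linked-head (IsPath.linked new-ear))))
      edges-off (there f∈W , f∈ds) with ∈-map⁻ proj₂ f∈W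
      ... | (v , f) , step∈W , refl with Linked-joins (IsPath.linked new-ear) (there step∈W)
      ...   | _ , j , _ = All.lookup off-W step∈W (cycle-edge-ends ds-cycle f∈ds j)
      θ′ : Theta
      θ′ = record
        { cyc = ds ; cyc-cycle = ds-cycle ; cyc-negative = ds-negative
        ; ear₀ = x , eₓ ; ear₊ = W ; end = proj₁ y ; ear-path = new-ear
        ; start-on-cyc = on-x ; end-on-cyc = on-y
        ; inner-off-cyc = off-vertices off-W ; ear-edges-off-cyc = edges-off }
      P⊆ear : pathVertices u P ⊆ Theta.earVertices θ′
      P⊆ear = there ∘ ∈-++⁺ˡ ∘ Subset.map⁺ proj₁ (Subset.xs⊆ys++xs _ tl) ∘ pathVertices⊆ P u e s₁
      longer : length (pathVertices u P) < length (Theta.earVertices θ′)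
      longer rewrite length-pathVertices u P | length-pathVertices (proj₁ y) ((x , eₓ) ∷ W) =
        s≤s (s≤s (begin
          length P                                  ≤⟨ ℕ.m≤m+n (length P) _ ⟩
          length P + length ((u , e) ∷ s₁)          ≡⟨ length-++ P ⟨
          length (P ++ (u , e) ∷ s₁)                ≤⟨ ℕ.m≤n+m _ (length tl) ⟩
          length tl + length (P ++ (u , e) ∷ s₁)    ≡⟨ length-++ tl ⟨
          length W                                  ∎))
        where open ℕ.≤-Reasoning

    extend : ∀ {P u e rs} → IsCycle (P ++ (u , e) ∷ rs) → Disjoint (pathVertices u P) (vertices ds) →
             Any (_∈ vertices ds) (vertices (P ++ (u , e) ∷ rs)) → Extension (pathVertices u P)
    extend {P} {u} {e} {rs} K off meets = extend-along-span (span on? meets-rs) K off-P off-u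
      where
      off-path : All (¬_ ∘ On) (P ++ [ (u , e) ])
      off-path = All.map⁻ (subst (All (_∉ vertices ds)) (sym (map-++ proj₁ P _))
                                 (All.tabulate λ v∈ v∈ds → off (v∈ , v∈ds)))
      off-P : All (¬_ ∘ On) P
      off-P = All.++⁻ˡ P off-path
      off-u : ¬ On (u , e)
      off-u with All.++⁻ʳ P off-path
      ... | off-u ∷ [] = off-u
      meets-rs : Any On rs
      meets-rs with Any.++⁻ P (Any.map⁻ meets)
      ... | inj₁ on-P         = ⊥-elim (All¬⇒¬Any off-P on-P)
      ... | inj₂ (here on-u)  = ⊥-elim (off-u on-u)
      ... | inj₂ (there on-rs) = on-rs

  -- ds is a negative cycle of G − V(Y) that is not a cycle of G − V(X).
  Distinguishing : List Step → List Step → List Step → Set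
  Distinguishing X Y ds =
    IsCycle ds × Negative ds × Disjoint (vertices ds) (vertices Y) × Any (_∈ vertices ds) (vertices X)

  joins? : ∀ e u w → Dec (Joins G e u w)
  joins? e u w = ends e ≟ (u , w) ⊎-dec ends e ≟ (w , u)
    where _≟_ = ×.≡-dec Fin._≟_ Fin._≟_

  linked? : ∀ t → Decidable (Linked t)
  linked? t []             = yes []
  linked? t ((v , e) ∷ ss) =
    map′ (λ (j , l) → j ∷ l) (λ where (j ∷ l) → j , l) (joins? e v (first t ss) ×-dec linked? t ss)

  isCycle? : Decidable IsCycle
  isCycle? []       = no λ ()
  isCycle? (s ∷ ss) = map′ (λ (l , uv , ue) → cycle l uv ue) (λ where (cycle l uv ue) → l , uv , ue)
    (linked? (proj₁ s) (s ∷ ss) ×-dec VertexUnique.unique? (vertices (s ∷ ss))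
                                ×-dec EdgeUnique.unique? (edges (s ∷ ss)))
    where
    module VertexUnique = Data.List.Relation.Unary.Unique.DecPropositional (Fin._≟_ {SignedGraph.n G})
    module EdgeUnique   = Data.List.Relation.Unary.Unique.DecPropositional (Fin._≟_ {SignedGraph.m G})

  distinguishing? : ∀ X Y → Dec (∃ (Distinguishing X Y))
  distinguishing? X Y =
    map′ (λ (ds , _ , d) → ds , d) (λ (ds , d) → ds , cycle-length≤ (proj₁ d) , d)
         (short-lists-searchable (×-searchable Fin.any? Fin.any?) (SignedGraph.n G) λ ds →
            isCycle? ds ×-dec negatives ds % 2 ℕ.≟ 1 ×-dec disjoint? (vertices ds)
              ×-dec Any.any? (_∈? vertices ds) (vertices X))
    where
    open import Data.List.Membership.DecPropositional (Fin._≟_ {SignedGraph.n G}) using (_∈?_; _∉?_)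
    disjoint? : ∀ xs → Dec (Disjoint xs (vertices Y))
    disjoint? xs = map′ (λ off (v∈xs , v∈Y) → All.lookup off v∈xs v∈Y)
                        (λ d → All.tabulate λ v∈xs v∈Y → d (v∈xs , v∈Y))
                        (All.all? (_∉? vertices Y) xs)

  record Separation (S : List (V G)) : Set where
    field
      C₀ C₁                : List Step
      C₀-cycle             : IsCycle C₀
      C₁-cycle             : IsCycle C₁
      opposite-signs       : (negatives C₀ + negatives C₁) % 2 ≡ 1
      S⊆C₀                 : S ⊆ vertices C₀
      S⊆C₁                 : S ⊆ vertices C₁
      same-negative-cycles : ∀ {ds} → IsCycle ds → Negative ds →
                             Disjoint (vertices ds) (vertices C₀) ⇔ Disjoint (vertices ds) (vertices C₁)

  Separation-⊆ : ∀ {S S′} → S ⊆ S′ → Separation S′ → Separation S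
  Separation-⊆ S⊆S′ sep = record
    { C₀-cycle = C₀-cycle ; C₁-cycle = C₁-cycle ; opposite-signs = opposite-signs
    ; S⊆C₀ = S⊆C₀ ∘ S⊆S′ ; S⊆C₁ = S⊆C₁ ∘ S⊆S′ ; same-negative-cycles = same-negative-cycles }
    where open Separation sep

  module _ (subcubic : Subcubic G) where
    open Theta
    open EarCycle

    separate-within : ∀ k θ → SignedGraph.n G < length (earVertices θ) + k → Separation (earVertices θ)
    separate-within zero θ bound = ⊥-elim (ℕ.<⇒≱ n<ear ear≤n)
      where
      n<ear = subst (SignedGraph.n G <_) (ℕ.+-identityʳ (length (earVertices θ))) bound
      ear≤n = Unique-length≤ (IsPath.vertices-unique (ear-path θ))
    separate-within (suc k) θ bound =
      decide (distinguishing? (steps X) (steps Y)) (distinguishing? (steps Y) (steps X))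
      where
      X = ear-then-arc₂ θ
      Y = reversed-ear-then-arc₁ θ

      continue : (Z : EarCycle θ) → Extension (pathVertices (meet Z) (along Z)) → Separation (earVertices θ)
      continue Z (θ′ , ear⊆ear′ , longer) =
        Separation-⊆ (ear⊆ear′ ∘ Subset.⊆-reflexive-↭ (↭-sym (along-ear Z))) (separate-within k θ′ bound′)
        where
        open ℕ.≤-Reasoning
        bound′ : SignedGraph.n G < length (earVertices θ′) + k
        bound′ = begin-strict
          SignedGraph.n G                                   <⟨ bound ⟩
          length (earVertices θ) + suc k                    ≡⟨ ℕ.+-suc _ k ⟩
          suc (length (earVertices θ)) + k                  ≡⟨ cong (λ l → suc l + k) (↭.↭-length (along-ear Z)) ⟨
          suc (length (pathVertices (meet Z) (along Z))) + k ≤⟨ ℕ.+-monoˡ-≤ k longer ⟩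
          length (earVertices θ′) + k                       ∎

      extend-through : ∀ {ds} (Z Z′ : EarCycle θ) → IsCycle ds → Negative ds →
                       Disjoint (vertices ds) (vertices (steps Z′)) → Any (_∈ vertices ds) (vertices (steps Z)) →
                       Extension (pathVertices (meet Z) (along Z))
      extend-through Z Z′ c neg off = extend subcubic c neg {along Z} {meet Z} {leave Z} {back Z} (isCycle Z)
        λ (v∈Z , v∈ds) → off (v∈ds , ear⊆ Z′ (Subset.⊆-reflexive-↭ (along-ear Z) v∈Z))

      meeting : ∀ {v xs ys} → v ∈ xs → v ∈ ys → Any (_∈ ys) xs
      meeting v∈xs v∈ys = Any.map (λ where refl → v∈ys) v∈xs

      decide : Dec (∃ (Distinguishing (steps X) (steps Y))) → Dec (∃ (Distinguishing (steps Y) (steps X))) →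
               Separation (earVertices θ)
      decide (yes (_ , c , neg , off-Y , meets-X)) _ = continue X (extend-through X Y c neg off-Y meets-X)
      decide _ (yes (_ , c , neg , off-X , meets-Y)) = continue Y (extend-through Y X c neg off-X meets-Y)
      decide (no none-XY) (no none-YX) = record
        { C₀ = steps X ; C₁ = steps Y ; C₀-cycle = isCycle X ; C₁-cycle = isCycle Y
        ; opposite-signs = ear-cycles-opposite θ ; S⊆C₀ = ear⊆ X ; S⊆C₁ = ear⊆ Y
        ; same-negative-cycles = λ c neg → mk⇔
            (λ off-X {_} (v∈ds , v∈Y) → none-YX (_ , c , neg , off-X , meeting v∈Y v∈ds))
            (λ off-Y {_} (v∈ds , v∈X) → none-XY (_ , c , neg , off-Y , meeting v∈X v∈ds))
        }

    separate : ∀ θ → Separation (earVertices θ)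
    separate θ = separate-within (SignedGraph.n G) θ
      (ℕ.m<n+m _ (subst (0 <_) (sym (length-pathVertices (end θ) (ear θ))) (s≤s z≤n)))

  -- Translation to and from the cycles and paths of Defs

  lookup-link : ∀ {t s ss} → Linked t (s ∷ ss) → ∀ (i : Fin (length ss)) →
    Joins G (proj₂ (lookup (s ∷ ss) (inject₁ i))) (proj₁ (lookup (s ∷ ss) (inject₁ i))) (proj₁ (lookup (s ∷ ss) (suc i)))
  lookup-link {ss = _ ∷ _} (j ∷ _)      zero    = j
  lookup-link {ss = _ ∷ _} (_ ∷ linked) (suc i) = lookup-link linked i

  lookup-close : ∀ {t s ss} → Linked t (s ∷ ss) →
    Joins G (proj₂ (lookup (s ∷ ss) (fromℕ (length ss)))) (proj₁ (lookup (s ∷ ss) (fromℕ (length ss)))) t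
  lookup-close {ss = []}    (j ∷ [])     = j
  lookup-close {ss = _ ∷ _} (_ ∷ linked) = lookup-close linked

  toCycle : ∀ {ss} → IsCycle ss → Cycle G
  toCycle {s ∷ ss} (cycle linked uv ue) = record
    { len       = length ss
    ; verts     = proj₁ ∘ lookup (s ∷ ss)
    ; edges     = proj₂ ∘ lookup (s ∷ ss)
    ; verts-inj = λ _ _ → lookup-injective proj₁ (s ∷ ss) uv
    ; edges-inj = λ _ _ → lookup-injective proj₂ (s ∷ ss) ue
    ; link      = lookup-link linked
    ; close     = lookup-close linked
    }

  toCycle-∈⁻ : ∀ {ss v} (c : IsCycle ss) → _∈V_ G v (toCycle c) → v ∈ vertices ss
  toCycle-∈⁻ (cycle _ _ _) (i , refl) = ∈-map⁺ proj₁ (∈-lookup i)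

  toCycle-∈⁺ : ∀ {ss v} (c : IsCycle ss) → v ∈ vertices ss → _∈V_ G v (toCycle c)
  toCycle-∈⁺ (cycle _ _ _) v∈ss with ∈-map⁻ proj₁ v∈ss
  ... | s , s∈ss , refl = Any.index s∈ss , cong proj₁ (sym (Any.lookup-index s∈ss))

  negCount-toCycle : ∀ {ss} (c : IsCycle ss) → negCount G (toCycle c) ≡ negatives ss
  negCount-toCycle {ss} (cycle _ _ _) =
    trans (cong sum (map-lookup-allFin (sign ∘ proj₂) ss)) (cong sum (map-∘ ss))

  stepAt : (C : Cycle G) → Fin (suc (Cycle.len C)) → Step
  stepAt C i = Cycle.verts C i , Cycle.edges C i

  fromCycle : Cycle G → List Step
  fromCycle C = tabulate (stepAt C)

  Linked-tabulate : ∀ {t} k (f : Fin (suc k) → V G) (g : Fin (suc k) → E G) →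
    (∀ (i : Fin k) → Joins G (g (inject₁ i)) (f (inject₁ i)) (f (suc i))) → Joins G (g (fromℕ k)) (f (fromℕ k)) t →
    Linked t (tabulate λ i → f i , g i)
  Linked-tabulate zero    f g link close = close ∷ []
  Linked-tabulate (suc k) f g link close = link zero ∷ Linked-tabulate k (f ∘ suc) (g ∘ suc) (link ∘ suc) close

  fromCycle-isCycle : ∀ C → IsCycle (fromCycle C)
  fromCycle-isCycle C = cycle
    (Linked-tabulate (Cycle.len C) (Cycle.verts C) (Cycle.edges C) (Cycle.link C) (Cycle.close C))
    (subst Unique (sym (map-tabulate (stepAt C) proj₁)) (Unique.tabulate⁺ λ {i} {j} → Cycle.verts-inj C i j))
    (subst Unique (sym (map-tabulate (stepAt C) proj₂)) (Unique.tabulate⁺ λ {i} {j} → Cycle.edges-inj C i j))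

  fromCycle-∈⁺ : ∀ C {v} → _∈V_ G v C → v ∈ vertices (fromCycle C)
  fromCycle-∈⁺ C (i , refl) =
    subst (Cycle.verts C i ∈_) (sym (map-tabulate (stepAt C) proj₁)) (∈-tabulate⁺ {f = Cycle.verts C} i)

  fromCycle-∈⁻ : ∀ C {v} → v ∈ vertices (fromCycle C) → _∈V_ G v C
  fromCycle-∈⁻ C {v} v∈ with ∈-tabulate⁻ {f = Cycle.verts C} (subst (v ∈_) (map-tabulate (stepAt C) proj₁) v∈)
  ... | i , v≡ = i , sym v≡

  fromCycle-∈E⁻ : ∀ C {e} → e ∈ edges (fromCycle C) → _∈E_ G e C
  fromCycle-∈E⁻ C {e} e∈ with ∈-tabulate⁻ {f = Cycle.edges C} (subst (e ∈_) (map-tabulate (stepAt C) proj₂) e∈)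
  ... | i , e≡ = i , sym e≡

  negatives-fromCycle : ∀ C → negatives (fromCycle C) ≡ negCount G C
  negatives-fromCycle C = begin
    sum (map sign (edges (fromCycle C)))         ≡⟨ cong (sum ∘ map sign) (map-tabulate (stepAt C) proj₂) ⟩
    sum (map sign (tabulate (Cycle.edges C)))    ≡⟨ cong sum (map-tabulate (Cycle.edges C) sign) ⟩
    sum (tabulate (sign ∘ Cycle.edges C))        ≡⟨ cong sum (map-tabulate id (sign ∘ Cycle.edges C)) ⟨
    negCount G C                                 ∎
    where open ≡-Reasoning

  fromCycle-negative : ∀ C → NegativeCycle G C → Negative (fromCycle C)
  fromCycle-negative C = trans (cong (_% 2) (negatives-fromCycle C))

  Avoids⇔Disjoint : ∀ D {ss} (c : IsCycle ss) → Avoids G D (toCycle c) ⇔ Disjoint (vertices (fromCycle D)) (vertices ss)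
  Avoids⇔Disjoint D c = mk⇔
    (λ avoids {_} (v∈D , v∈ss) → avoids _ (fromCycle-∈⁻ D v∈D) (toCycle-∈⁺ c v∈ss))
    (λ disjoint v v∈D v∈C → disjoint (fromCycle-∈⁺ D v∈D , toCycle-∈⁻ c v∈C))

  first-tabulate : ∀ k (f : Fin (suc k) → V G) (g : Fin k → E G) →
                   first (f (fromℕ k)) (tabulate λ i → f (inject₁ i) , g i) ≡ f zero
  first-tabulate zero    f g = refl
  first-tabulate (suc k) f g = refl

  Linked-tabulate-path : ∀ k (f : Fin (suc k) → V G) (g : Fin k → E G) →
    (∀ i → Joins G (g i) (f (inject₁ i)) (f (suc i))) → Linked (f (fromℕ k)) (tabulate λ i → f (inject₁ i) , g i)
  Linked-tabulate-path zero    f g link = []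
  Linked-tabulate-path (suc k) f g link =
    subst (Joins G (g zero) (f zero)) (sym (first-tabulate k (f ∘ suc) (g ∘ suc))) (link zero)
      ∷ Linked-tabulate-path k (f ∘ suc) (g ∘ suc) (link ∘ suc)

  pathVertices-tabulate : ∀ k (f : Fin (suc k) → V G) (g : Fin k → E G) →
                          pathVertices (f (fromℕ k)) (tabulate λ i → f (inject₁ i) , g i) ≡ tabulate f
  pathVertices-tabulate zero    f g = refl
  pathVertices-tabulate (suc k) f g = cong (f zero ∷_) (pathVertices-tabulate k (f ∘ suc) (g ∘ suc))

  theta-of-good-pair : ∀ {D Q} → GoodThetaPair G D Q → Σ Theta λ θ → ∀ i → Path.verts Q i ∈ Theta.earVertices θ
  theta-of-good-pair {Q = record { len = zero }} (_ , _ , _ , _ , _ , zero , zero , 0≢0 , _) = ⊥-elim (0≢0 refl)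
  theta-of-good-pair {D}
    {record { len = suc l ; verts = f ; edges = g ; verts-inj = f-inj ; edges-inj = g-inj ; link = link }}
    (negative , start-on , end-on , inner-off , edges-off , _) = θ , on-ear
    where
    step : Fin (suc l) → Step
    step i = f (inject₁ i) , g i
    θ : Theta
    θ = record
      { cyc               = fromCycle D
      ; cyc-cycle         = fromCycle-isCycle D
      ; cyc-negative      = fromCycle-negative D negative
      ; ear₀              = step zero
      ; ear₊              = tabulate (step ∘ suc)
      ; end               = f (fromℕ (suc l))
      ; ear-path          = path (Linked-tabulate-path (suc l) f g link)
                                 (subst Unique (sym (pathVertices-tabulate (suc l) f g)) (Unique.tabulate⁺ (f-inj _ _)))
                                 (subst Unique (sym (map-tabulate step proj₂)) (Unique.tabulate⁺ (g-inj _ _)))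
      ; start-on-cyc      = fromCycle-∈⁺ D start-on
      ; end-on-cyc        = fromCycle-∈⁺ D end-on
      ; inner-off-cyc     = inner-off′
      ; ear-edges-off-cyc = edges-off′
      }
      where
      inner-off′ : Disjoint (vertices (tabulate (step ∘ suc))) (vertices (fromCycle D))
      inner-off′ {v} (v∈inner , v∈D)
        with ∈-tabulate⁻ {f = proj₁ ∘ step ∘ suc} (subst (v ∈_) (map-tabulate (step ∘ suc) proj₁) v∈inner)
      ... | i , refl =
        inner-off (suc (inject₁ i)) (λ ()) (Fin.fromℕ≢inject₁ ∘ sym ∘ Fin.suc-injective) (fromCycle-∈⁻ D v∈D)
      edges-off′ : Disjoint (edges (tabulate step)) (edges (fromCycle D))
      edges-off′ {e} (e∈ear , e∈D) with ∈-tabulate⁻ {f = g} (subst (e ∈_) (map-tabulate step proj₂) e∈ear)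
      ... | i , refl = edges-off i (fromCycle-∈E⁻ D e∈D)
    on-ear : ∀ i → f i ∈ Theta.earVertices θ
    on-ear i = subst (f i ∈_) (sym (pathVertices-tabulate (suc l) f g)) (∈-tabulate⁺ {f = f} i)

  TwoV2Path⇒TwoV2Cycle : ∀ {Q C} → (∀ i → _∈V_ G (Path.verts Q i) C) → TwoV2Path G Q → TwoV2Cycle G C
  TwoV2Path⇒TwoV2Cycle {Q} {C} on-C (i , j , i≢j , deg-i , deg-j) with on-C i | on-C j
  ... | i′ , at-i | j′ , at-j =
    i′ , j′ , (λ i′≡j′ → i≢j (Path.verts-inj Q i j (trans (sym at-i) (trans (cong (Cycle.verts C) i′≡j′) at-j))))
    , subst (λ v → deg G v ≡ 2) (sym at-i) deg-i , subst (λ v → deg G v ≡ 2) (sym at-j) deg-j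

  Lemma4p1Conclusion : Set
  Lemma4p1Conclusion = Σ (Cycle G) λ C₀ → Σ (Cycle G) λ C₁ →
    (NegativeCycle G C₁ × GoodCycle G C₀) × TwoV2Cycle G C₁ ×
    (∀ (D : Cycle G) → NegativeCycle G D → (Avoids G D C₀ ⇔ Avoids G D C₁))

  opposite-cycles⇒conclusion : (X Y : Cycle G) → (negCount G X + negCount G Y) % 2 ≡ 1 →
    TwoV2Cycle G X → TwoV2Cycle G Y → (∀ D → NegativeCycle G D → Avoids G D X ⇔ Avoids G D Y) → Lemma4p1Conclusion
  opposite-cycles⇒conclusion X Y opposite two-X two-Y same with odd-sum-parities (negCount G X) (negCount G Y) opposite
  ... | inj₁ (X-positive , Y-negative) = X , Y , (Y-negative , X-positive , two-X) , two-Y , same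
  ... | inj₂ (X-negative , Y-positive) = Y , X , (X-negative , Y-positive , two-Y) , two-X , λ D neg → ⇔.sym (same D neg)

  separation⇒conclusion : ∀ {S} {Q : Path G} → Separation S → (∀ i → Path.verts Q i ∈ S) → TwoV2Path G Q →
                          Lemma4p1Conclusion
  separation⇒conclusion {Q = Q} sep Q⊆S two = opposite-cycles⇒conclusion (toCycle C₀-cycle) (toCycle C₁-cycle)
    (subst (λ k → k % 2 ≡ 1) (sym (cong₂ _+_ (negCount-toCycle C₀-cycle) (negCount-toCycle C₁-cycle))) opposite-signs)
    (TwoV2Path⇒TwoV2Cycle {Q} {toCycle C₀-cycle} (toCycle-∈⁺ C₀-cycle ∘ S⊆C₀ ∘ Q⊆S) two)
    (TwoV2Path⇒TwoV2Cycle {Q} {toCycle C₁-cycle} (toCycle-∈⁺ C₁-cycle ∘ S⊆C₁ ∘ Q⊆S) two)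
    λ D neg → ⇔.trans (Avoids⇔Disjoint D C₀-cycle)
                (⇔.trans (same-negative-cycles (fromCycle-isCycle D) (fromCycle-negative D neg))
                         (⇔.sym (Avoids⇔Disjoint D C₁-cycle)))
    where open Separation sep

lemma4p1 : (G : SignedGraph) → WellBehaved G → HasGoodThetaPair G →
    Σ (Cycle G) λ C₀ → Σ (Cycle G) λ C₁ →
      (NegativeCycle G C₁ × GoodCycle G C₀) ×
      TwoV2Cycle G C₁ ×
      (∀ (D : Cycle G) → NegativeCycle G D → (Avoids G D C₀ ⇔ Avoids G D C₁))
lemma4p1 G (subcubic , _) (D , Q , pair@(_ , _ , _ , _ , _ , two-V₂)) with theta-of-good-pair G {D} {Q} pair
... | θ , Q-on-ear = separation⇒conclusion G {Q = Q} (separate G subcubic θ) Q-on-ear two-V₂
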